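{- Let $S$ be a scheduling problem on $n$ items. Then the scheduling counting function $\chi_S(k)$ is a polynomial in $k$ of degree at most $n$, and $$\chi_S(k)=\sum_{i=1}^n f_i\binom{k}{i},$$ where for each $i$ the coefficient $f_i$ is the (non-negative integer) number of ordered set partitions $\Phi$ of $[n]$ with exactly $i$ blocks that solve $S$. In particular $0\le f_i\le i!\cdot S(n,i)$, where $S(n,i)$ denotes the Stirling number of the second kind.
   Context: Let $n\ge 1$ and $[n]=\{1,\dots,n\}$. A scheduling problem on $n$ items is a boolean formula $S$ in variables $x_1,\dots,x_n$ built, using the boolean connectives, from atomic formulas of the form $x_i\le x_j$ with $i,j\in[n]$. For a positive integer $k$, a $k$-schedule solving $S$ is an integer vector $a\in[k]^n$ such that $S$ is true when $x_i=a_i$ for all $i$; the scheduling counting function $\chi_S(k)$ is the number of $k$-schedules solving $S$. An ordered set partition of $[n]$ is a sequence $\Phi=(\Phi_1|\Phi_2|\cdots|\Phi_\ell)$ of non-empty, pairwise disjoint subsets (blocks) with union $[n]$ (elements within a block are unordered). For $a\in\mathbb{R}^n$, let $\Delta(a)$ be the ordered set partition such that $a$ is constant on each block and $a|_{\Delta_i}<a|_{\Delta_{i+1}}$ for all $i$. The truth value of $S$ at $a$ depends only on $\Delta(a)$; an ordered set partition $\Phi$ solves $S$ if $S$ is true at some (equivalently, every) $a$ with $\Delta(a)=\Phi$. -}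

module Defs where

open import Data.Bool using (Bool; true; false; not; _∧_; _∨_; if_then_else_)
open import Data.Nat using (ℕ; zero; suc; _+_; _*_; _≤ᵇ_; _<ᵇ_)
open import Data.Fin using (Fin; toℕ)
open import Data.List using (List; []; _∷_; map; concatMap; filterᵇ; length; allFin; upTo)
open import Data.Bool.ListAction using (and; or)
open import Data.Nat.ListAction using (sum)
open import Data.Vec using (Vec; []; _∷_; lookup; tabulate; toList)
open import Data.Nat.Combinatorics using (_C_)

-- Scheduling problems on n items (items are Fin n, i.e. [n] shifted to 0-based).
-- Boolean formulas built from atoms  x_i ≤ x_j  with the boolean connectives.

data Formula (n : ℕ) : Set where
  atom  : Fin n → Fin n → Formula n
  tt ff : Formula n
  ¬f    : Formula n → Formula n
  _∧f_ _∨f_ _⇒f_ _⇔f_ : Formula n → Formula n → Formula n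

_⇔ᵇ_ : Bool → Bool → Bool
true  ⇔ᵇ b = b
false ⇔ᵇ b = not b

eval : ∀ {n} → Formula n → Vec ℕ n → Bool
eval (atom i j) a = lookup a i ≤ᵇ lookup a j
eval tt a = true
eval ff a = false
eval (¬f s) a = not (eval s a)
eval (s ∧f t) a = eval s a ∧ eval t a
eval (s ∨f t) a = eval s a ∨ eval t a
eval (s ⇒f t) a = not (eval s a) ∨ eval t a
eval (s ⇔f t) a = eval s a ⇔ᵇ eval t a

vecsOf : ∀ {A : Set} → List A → (n : ℕ) → List (Vec A n)
vecsOf xs zero    = [] ∷ []
vecsOf xs (suc n) = concatMap (λ x → map (x ∷_) (vecsOf xs n)) xs

-- k-schedules: vectors a ∈ [k]^n (entry  r : Fin k  stands for r+1 ∈ [k]).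

schedule : ∀ {n k} → Vec (Fin k) n → Vec ℕ n
schedule a = tabulate (λ i → suc (toℕ (lookup a i)))

χ : ∀ {n} → Formula n → ℕ → ℕ
χ {n} S k = length (filterᵇ (λ a → eval S (schedule a)) (vecsOf (allFin k) n))

-- Ordered set partitions of [n] with ℓ blocks: sequences (Φ_1 | … | Φ_ℓ)
-- of subsets of [n] (a subset is its characteristic vector Vec Bool n)
-- that are non-empty, pairwise disjoint and cover [n].

Block : ℕ → Set
Block n = Vec Bool n

nonemptyᵇ : ∀ {n} → Block n → Bool
nonemptyᵇ b = or (toList b)

disjointᵇ : ∀ {n} → Block n → Block n → Bool
disjointᵇ {n} b c = and (map (λ j → not (lookup b j ∧ lookup c j)) (allFin n))

isOSPᵇ : ∀ {n ℓ} → Vec (Block n) ℓ → Bool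
isOSPᵇ {n} {ℓ} Φ =
  and (map (λ t → nonemptyᵇ (lookup Φ t)) (allFin ℓ))
  ∧ and (concatMap (λ t → map (λ t' → (toℕ t <ᵇ toℕ t') ⇒ disjointᵇ (lookup Φ t) (lookup Φ t'))
                              (allFin ℓ)) (allFin ℓ))
  ∧ and (map (λ j → or (map (λ t → lookup (lookup Φ t) j) (allFin ℓ))) (allFin n))
  where
  _⇒_ : Bool → Bool → Bool
  p ⇒ q = not p ∨ q

blockOf : ∀ {n ℓ} → Vec (Block n) ℓ → Fin n → ℕ
blockOf [] j = 0
blockOf (b ∷ Φ) j = if lookup b j then 1 else suc (blockOf Φ j)

-- The canonical vector a with Δ(a) = Φ: a_j = index of the block containing j.
-- (Constant on blocks, strictly increasing from block to block.)
canonical : ∀ {n ℓ} → Vec (Block n) ℓ → Vec ℕ n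
canonical Φ = tabulate (blockOf Φ)

-- Φ solves S iff S is true at some (equivalently every) a with Δ(a) = Φ;
-- we evaluate at the canonical such a.
solvesᵇ : ∀ {n ℓ} → Formula n → Vec (Block n) ℓ → Bool
solvesᵇ S Φ = eval S (canonical Φ)

f : ∀ {n} → Formula n → ℕ → ℕ
f {n} S i = length (filterᵇ (λ Φ → isOSPᵇ Φ ∧ solvesᵇ S Φ)
                            (vecsOf (vecsOf (true ∷ false ∷ []) n) i))

Σ₁ : ℕ → (ℕ → ℕ) → ℕ
Σ₁ n g = sum (map (λ i → g (suc i)) (upTo n))

Stirling2 : ℕ → ℕ → ℕ
Stirling2 zero zero = 1
Stirling2 zero (suc k) = 0
Stirling2 (suc n) zero = 0
Stirling2 (suc n) (suc k) = suc k * Stirling2 n (suc k) + Stirling2 n k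

-- An ordered set partition of [n] with i blocks is the same thing as a surjection
-- c : [n] → [0, i) (c j is the index of the block containing j), and S holds at a vector
-- exactly when it holds at any vector of the same order type. Let N j r count the vectors
-- in [0, j + r)ⁿ that satisfy S and use every value below j. A vector that misses the value
-- j can be compressed by closing the gap, which preserves its order type; hence
-- N j (r + 1) = N (j + 1) r + N j r, and by Pascal's rule N 0 k = Σ_t C(k, t) · N t 0,
-- where N t 0 counts the surjections solving S, i.e. f_t. Dropping S, the surjections onto
-- [0, i) satisfy the recurrence of i! · S(n, i), splitting on the value of the first entry.

module Submission where

open import Defs
open import Data.Nat using (ℕ; _*_; _≤_; _!)
open import Data.Nat.Combinatorics using (_C_)
open import Data.Product using (_×_)
open import Relation.Binary.PropositionalEquality using (_≡_)

open import Data.Bool using (Bool; true; false; not; _∧_; _∨_; T; if_then_else_)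
import Data.Bool.Properties as Bool
open import Data.Bool.ListAction using (and; or)
open import Data.Empty using (⊥; ⊥-elim)
open import Data.Fin using (Fin; toℕ)
import Data.Fin as Fin
import Data.Fin.Properties as Finₚ
open import Data.List using (List; []; _∷_; _++_; concatMap; filterᵇ; length; allFin; map; tabulate; applyUpTo)
import Data.List.Properties as Listₚ
open import Data.List.Membership.Propositional using (lose) renaming (_∈_ to _∈ₗ_)
open import Data.List.Membership.Propositional.Properties using (∈-allFin)
import Data.List.Relation.Unary.All as ListAll
open ListAll using ([]; _∷_)
import Data.List.Relation.Unary.All.Properties as ListAllₚ
import Data.List.Relation.Unary.Any as ListAny
open ListAny using (here; there)
import Data.List.Relation.Unary.Any.Properties as ListAnyₚ
open import Data.Nat using (zero; suc; z<s; _+_; _<_; _∸_; z≤n; s≤s; _≤ᵇ_; _<ᵇ_; _≡ᵇ_; _<?_; _≟_)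
import Data.Nat.Properties as ℕ
open import Algebra.Properties.CommutativeSemigroup ℕ.+-commutativeSemigroup using (interchange; x∙yz≈y∙xz)
open import Data.Nat.Combinatorics using (nCk+nC[k+1]≡[n+1]C[k+1])
open import Data.Nat.ListAction using (sum)
open import Data.Nat.Solver using (module +-*-Solver)
open import Data.Product using (∃-syntax; _,_; proj₁; proj₂)
open import Data.Sum using (inj₁; inj₂; [_,_])
open import Data.Vec using (Vec; []; _∷_; lookup; zipWith; replicate)
import Data.Vec as Vec
import Data.Vec.Properties as Vecₚ
open import Data.Vec.Membership.DecPropositional _≟_ using (_∈_; _∈?_)
open import Data.Vec.Membership.Propositional.Properties using (∈-map⁺; ∈-lookup)
open import Data.Vec.Relation.Unary.All using (All; []; _∷_)
import Data.Vec.Relation.Unary.All as VecAll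
import Data.Vec.Relation.Unary.All.Properties as VecAllₚ
open import Data.Vec.Relation.Unary.Any using (Any; here; there)
import Data.Vec.Relation.Unary.Any as VecAny
import Data.Vec.Relation.Unary.Any.Properties as VecAnyₚ
open import Function using (id; _∘_; _⇔_; Equivalence; mk⇔)
open import Relation.Binary.PropositionalEquality
  using (_≢_; refl; sym; trans; cong; cong₂; subst; subst₂; module ≡-Reasoning)
open import Relation.Nullary using (¬_; yes; no)
open import Relation.Nullary.Decidable using (⌊_⌋; toWitness; fromWitness; fromWitnessFalse)

open ≡-Reasoning
open Equivalence using (to; from)

private variable
  A B : Set

T-injective : {a b : Bool} → (T a → T b) → (T b → T a) → a ≡ b
T-injective {false} {false} _  _  = refl
T-injective {false} {true}  _  b⇒a = ⊥-elim (b⇒a _)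
T-injective {true}  {false} a⇒b _  = ⊥-elim (a⇒b _)
T-injective {true}  {true}  _  _  = refl

T-not : {b : Bool} → T (not b) ⇔ (¬ T b)
T-not {false} = mk⇔ (λ _ ()) (λ _ → _)
T-not {true}  = mk⇔ (λ ()) (λ ¬⊤ → ¬⊤ _)

T-<ᵇ⇒ : (m n : ℕ) {d : Bool} → T (not (m <ᵇ n) ∨ d) ⇔ (m < n → T d)
T-<ᵇ⇒ m n {d} = mk⇔ sound complete
  where
  sound : T (not (m <ᵇ n) ∨ d) → m < n → T d
  sound p m<n = [ (λ m≮n → ⊥-elim (to T-not m≮n (ℕ.<⇒<ᵇ m<n))) , id ] (to (Bool.T-∨ {not (m <ᵇ n)}) p)
  complete : (m < n → T d) → T (not (m <ᵇ n) ∨ d)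
  complete h with m <? n
  ... | yes m<n = from (Bool.T-∨ {not (m <ᵇ n)}) (inj₂ (h m<n))
  ... | no  m≮n = from Bool.T-∨ (inj₁ (from T-not (m≮n ∘ ℕ.<ᵇ⇒< m n)))

T-and : (bs : List Bool) → T (and bs) ⇔ ListAll.All T bs
T-and []       = mk⇔ (λ _ → []) (λ _ → _)
T-and (b ∷ bs) = mk⇔ (λ p → let pb , pbs = to Bool.T-∧ p in pb ∷ to (T-and bs) pbs)
                     (λ { (pb ∷ pbs) → from Bool.T-∧ (pb , from (T-and bs) pbs) })

T-or : (bs : List Bool) → T (or bs) ⇔ ListAny.Any T bs
T-or []       = mk⇔ (λ ()) (λ ())
T-or (b ∷ bs) = mk⇔ (λ p → [ here , there ∘ to (T-or bs) ] (to (Bool.T-∨ {b}) p))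
                    (λ { (here pb) → from Bool.T-∨ (inj₁ pb)
                       ; (there pbs) → from (Bool.T-∨ {b}) (inj₂ (from (T-or bs) pbs)) })

T-all-allFin : {k : ℕ} (p : Fin k → Bool) → T (and (map p (allFin k))) ⇔ (∀ t → T (p t))
T-all-allFin {k} p = mk⇔
  (λ h t → ListAll.lookup (ListAllₚ.map⁻ (to (T-and (map p (allFin k))) h)) (∈-allFin t))
  (λ h → from (T-and (map p (allFin k))) (ListAllₚ.map⁺ (ListAll.tabulate (λ {t} _ → h t))))

T-any-allFin : {k : ℕ} (p : Fin k → Bool) → T (or (map p (allFin k))) ⇔ (∃[ t ] T (p t))
T-any-allFin {k} p = mk⇔
  (λ h → ListAny.satisfied (ListAnyₚ.map⁻ (to (T-or (map p (allFin k))) h)))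
  (λ (t , pt) → from (T-or (map p (allFin k))) (ListAnyₚ.map⁺ (lose (∈-allFin t) pt)))

T-all-concatMap-allFin : {k : ℕ} (g : Fin k → List Bool) →
  T (and (concatMap g (allFin k))) ⇔ (∀ t → T (and (g t)))
T-all-concatMap-allFin {k} g = mk⇔
  (λ h t → from (T-and (g t)) (ListAll.lookup (ListAllₚ.map⁻ (ListAllₚ.concat⁻ (to (T-and gs) h))) (∈-allFin t)))
  (λ h → from (T-and gs) (ListAllₚ.concat⁺ {xss = map g (allFin k)}
                           (ListAllₚ.map⁺ (ListAll.tabulate (λ {t} _ → to (T-and (g t)) (h t))))))
  where
  gs : List Bool
  gs = concatMap g (allFin k)

T-or-toList : {k : ℕ} (b : Vec Bool k) → T (or (Vec.toList b)) ⇔ (∃[ t ] T (lookup b t))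
T-or-toList []      = mk⇔ (λ ()) (λ ())
T-or-toList (x ∷ b) = mk⇔
  (λ p → [ (λ px → Fin.zero , px) , (λ pb → let t , pt = to (T-or-toList b) pb in Fin.suc t , pt) ]
           (to (Bool.T-∨ {x}) p))
  (λ { (Fin.zero , px)  → from Bool.T-∨ (inj₁ px)
     ; (Fin.suc t , pt) → from (Bool.T-∨ {x}) (inj₂ (from (T-or-toList b) (t , pt))) })

ind : Bool → ℕ
ind true  = 1
ind false = 0

ΣL : List A → (A → ℕ) → ℕ
ΣL []       F = 0
ΣL (x ∷ xs) F = F x + ΣL xs F

ΣL-cong∈ : (xs : List A) {F G : A → ℕ} → (∀ x → x ∈ₗ xs → F x ≡ G x) → ΣL xs F ≡ ΣL xs G
ΣL-cong∈ []       h = refl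
ΣL-cong∈ (x ∷ xs) h = cong₂ _+_ (h x (here refl)) (ΣL-cong∈ xs (λ y y∈xs → h y (there y∈xs)))

ΣL-cong : (xs : List A) {F G : A → ℕ} → (∀ x → F x ≡ G x) → ΣL xs F ≡ ΣL xs G
ΣL-cong xs h = ΣL-cong∈ xs (λ x _ → h x)

ΣL-zero : (xs : List A) {F : A → ℕ} → (∀ x → F x ≡ 0) → ΣL xs F ≡ 0
ΣL-zero []       h = refl
ΣL-zero (x ∷ xs) h = cong₂ _+_ (h x) (ΣL-zero xs h)

ΣL-++ : (xs ys : List A) (F : A → ℕ) → ΣL (xs ++ ys) F ≡ ΣL xs F + ΣL ys F
ΣL-++ []       ys F = refl
ΣL-++ (x ∷ xs) ys F = trans (cong (F x +_) (ΣL-++ xs ys F)) (sym (ℕ.+-assoc (F x) _ _))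

ΣL-map : (g : A → B) (xs : List A) (F : B → ℕ) → ΣL (map g xs) F ≡ ΣL xs (F ∘ g)
ΣL-map g []       F = refl
ΣL-map g (x ∷ xs) F = cong (F (g x) +_) (ΣL-map g xs F)

ΣL-concatMap : (g : A → List B) (xs : List A) (F : B → ℕ) →
  ΣL (concatMap g xs) F ≡ ΣL xs (λ x → ΣL (g x) F)
ΣL-concatMap g []       F = refl
ΣL-concatMap g (x ∷ xs) F =
  trans (ΣL-++ (g x) (concatMap g xs) F) (cong (ΣL (g x) F +_) (ΣL-concatMap g xs F))

ΣL-+ : (xs : List A) (F G : A → ℕ) → ΣL xs (λ x → F x + G x) ≡ ΣL xs F + ΣL xs G
ΣL-+ []       F G = refl
ΣL-+ (x ∷ xs) F G =
  trans (cong (F x + G x +_) (ΣL-+ xs F G)) (interchange (F x) (G x) (ΣL xs F) (ΣL xs G))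

ΣL-swap : (xs : List A) (ys : List B) (H : A → B → ℕ) →
  ΣL xs (λ x → ΣL ys (H x)) ≡ ΣL ys (λ y → ΣL xs (λ x → H x y))
ΣL-swap []       ys H = sym (ΣL-zero ys (λ _ → refl))
ΣL-swap (x ∷ xs) ys H =
  trans (cong (ΣL ys (H x) +_) (ΣL-swap xs ys H)) (sym (ΣL-+ ys (H x) (λ y → ΣL xs (λ x → H x y))))

ΣL-mono-≤ : (xs : List A) {F G : A → ℕ} → (∀ x → F x ≤ G x) → ΣL xs F ≤ ΣL xs G
ΣL-mono-≤ []       h = z≤n
ΣL-mono-≤ (x ∷ xs) h = ℕ.+-mono-≤ (h x) (ΣL-mono-≤ xs h)

ΣL-const : (xs : List A) (c : ℕ) → ΣL xs (λ _ → c) ≡ length xs * c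
ΣL-const []       c = refl
ΣL-const (x ∷ xs) c = cong (c +_) (ΣL-const xs c)

length-filterᵇ : (p : A → Bool) (xs : List A) → length (filterᵇ p xs) ≡ ΣL xs (ind ∘ p)
length-filterᵇ p []       = refl
length-filterᵇ p (x ∷ xs) with p x
... | true  = cong suc (length-filterᵇ p xs)
... | false = length-filterᵇ p xs

ΣV : (n : ℕ) → List A → (Vec A n → ℕ) → ℕ
ΣV n xs F = ΣL (vecsOf xs n) F

ΣV-suc : (n : ℕ) (xs : List A) (F : Vec A (suc n) → ℕ) →
  ΣV (suc n) xs F ≡ ΣL xs (λ x → ΣV n xs (λ v → F (x ∷ v)))
ΣV-suc n xs F = trans (ΣL-concatMap (λ x → map (x ∷_) (vecsOf xs n)) xs F)
                      (ΣL-cong xs (λ x → ΣL-map (x ∷_) (vecsOf xs n) F))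

ΣV-cong∈ : (n : ℕ) (xs : List A) {F G : Vec A n → ℕ} →
  (∀ v → All (_∈ₗ xs) v → F v ≡ G v) → ΣV n xs F ≡ ΣV n xs G
ΣV-cong∈ zero    xs h = cong (_+ 0) (h [] [])
ΣV-cong∈ (suc n) xs {F} {G} h = begin
  ΣV (suc n) xs F                           ≡⟨ ΣV-suc n xs F ⟩
  ΣL xs (λ x → ΣV n xs (λ v → F (x ∷ v)))
    ≡⟨ ΣL-cong∈ xs (λ x x∈xs → ΣV-cong∈ n xs (λ v v⊆xs → h (x ∷ v) (x∈xs ∷ v⊆xs))) ⟩
  ΣL xs (λ x → ΣV n xs (λ v → G (x ∷ v)))   ≡⟨ ΣV-suc n xs G ⟨
  ΣV (suc n) xs G                           ∎

ΣV-cong : (n : ℕ) (xs : List A) {F G : Vec A n → ℕ} → (∀ v → F v ≡ G v) → ΣV n xs F ≡ ΣV n xs G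
ΣV-cong n xs h = ΣL-cong (vecsOf xs n) h

-- A change of variables x = e y in one coordinate, valid for summands vanishing at Bad
-- points, extends to all coordinates for summands vanishing when some coordinate is Bad.
ΣV-reindex : (n : ℕ) (Bad : A → Set) (xs : List A) (ys : List B) (e : B → A) →
  (∀ G → (∀ x → Bad x → G x ≡ 0) → ΣL xs G ≡ ΣL ys (G ∘ e)) →
  (F : Vec A n → ℕ) → (∀ v → Any Bad v → F v ≡ 0) → ΣV n xs F ≡ ΣV n ys (F ∘ Vec.map e)
ΣV-reindex zero    Bad xs ys e reindex₁ F F-bad = refl
ΣV-reindex (suc n) Bad xs ys e reindex₁ F F-bad = begin
  ΣV (suc n) xs F                                            ≡⟨ ΣV-suc n xs F ⟩
  ΣL xs (λ x → ΣV n xs (λ v → F (x ∷ v)))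
    ≡⟨ ΣL-cong xs (λ x → ΣV-reindex n Bad xs ys e reindex₁ _ (λ v bad → F-bad (x ∷ v) (there bad))) ⟩
  ΣL xs (λ x → ΣV n ys (λ w → F (x ∷ Vec.map e w)))
    ≡⟨ reindex₁ _ (λ x bad → ΣL-zero (vecsOf ys n) (λ w → F-bad (x ∷ Vec.map e w) (here bad))) ⟩
  ΣL ys (λ y → ΣV n ys (λ w → F (e y ∷ Vec.map e w)))       ≡⟨ ΣV-suc n ys (F ∘ Vec.map e) ⟨
  ΣV (suc n) ys (F ∘ Vec.map e)                              ∎

ΣV-map : (n : ℕ) (e : B → A) (ys : List B) (F : Vec A n → ℕ) → ΣV n (map e ys) F ≡ ΣV n ys (F ∘ Vec.map e)
ΣV-map n e ys F =
  ΣV-reindex n (λ _ → ⊥) (map e ys) ys e (λ G _ → ΣL-map e ys G) F (λ _ → ⊥-elim ∘ proj₂ ∘ VecAny.satisfied)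

transpose : {i n : ℕ} → Vec (Vec A i) n → Vec (Vec A n) i
transpose {i = i} []        = replicate i []
transpose         (c ∷ cs) = zipWith _∷_ c (transpose cs)

lookup-transpose : {i n : ℕ} (M : Vec (Vec A i) n) (t : Fin i) (j : Fin n) →
  lookup (lookup (transpose M) t) j ≡ lookup (lookup M j) t
lookup-transpose (c ∷ cs) t j =
  trans (cong (λ row → lookup row j) (Vecₚ.lookup-zipWith _∷_ t c (transpose cs))) (lookup-transpose′ j)
  where
  lookup-transpose′ : ∀ j → lookup (lookup c t ∷ lookup (transpose cs) t) j ≡ lookup (lookup (c ∷ cs) j) t
  lookup-transpose′ Fin.zero    = refl
  lookup-transpose′ (Fin.suc j) = lookup-transpose cs t j

ΣV-singleton : (i : ℕ) (y : A) (F : Vec A i → ℕ) → ΣV i (y ∷ []) F ≡ F (replicate i y)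
ΣV-singleton zero    y F = ℕ.+-identityʳ (F [])
ΣV-singleton (suc i) y F =
  trans (ΣV-suc i (y ∷ []) F) (trans (ℕ.+-identityʳ _) (ΣV-singleton i y (λ v → F (y ∷ v))))

ΣV-splitColumn : (i n : ℕ) (xs : List A) (F : Vec (Vec A (suc n)) i → ℕ) →
  ΣV i (vecsOf xs (suc n)) F ≡ ΣV i xs (λ c → ΣV i (vecsOf xs n) (λ M → F (zipWith _∷_ c M)))
ΣV-splitColumn zero    n xs F = cong (_+ 0) (sym (ℕ.+-identityʳ (F [])))
ΣV-splitColumn (suc i) n xs F = begin
  ΣV (suc i) (vecsOf xs (suc n)) F
    ≡⟨ ΣV-suc i (vecsOf xs (suc n)) F ⟩
  ΣV (suc n) xs (λ r → ΣV i (vecsOf xs (suc n)) (λ M → F (r ∷ M)))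
    ≡⟨ ΣL-cong (vecsOf xs (suc n)) (λ r → ΣV-splitColumn i n xs (λ M → F (r ∷ M))) ⟩
  ΣV (suc n) xs (λ r → ΣV i xs (λ c → ΣV i (vecsOf xs n) (λ M → F (r ∷ zipWith _∷_ c M))))
    ≡⟨ ΣV-suc n xs _ ⟩
  ΣL xs (λ x → ΣV n xs (λ r → ΣV i xs (λ c → ΣV i (vecsOf xs n) (λ M → F ((x ∷ r) ∷ zipWith _∷_ c M)))))
    ≡⟨ ΣL-cong xs (λ x → ΣL-swap (vecsOf xs n) (vecsOf xs i) _) ⟩
  ΣL xs (λ x → ΣV i xs (λ c → ΣV n xs (λ r → ΣV i (vecsOf xs n) (λ M → F ((x ∷ r) ∷ zipWith _∷_ c M)))))
    ≡⟨ ΣL-cong xs (λ x → ΣL-cong (vecsOf xs i) (λ c → ΣV-suc i (vecsOf xs n) _)) ⟨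
  ΣL xs (λ x → ΣV i xs (λ c → ΣV (suc i) (vecsOf xs n) (λ M → F (zipWith _∷_ (x ∷ c) M))))
    ≡⟨ ΣV-suc i xs _ ⟨
  ΣV (suc i) xs (λ c → ΣV (suc i) (vecsOf xs n) (λ M → F (zipWith _∷_ c M))) ∎

ΣV-transpose : (i n : ℕ) (xs : List A) (F : Vec (Vec A n) i → ℕ) →
  ΣV i (vecsOf xs n) F ≡ ΣV n (vecsOf xs i) (F ∘ transpose)
ΣV-transpose i zero    xs F = trans (ΣV-singleton i [] F) (sym (ℕ.+-identityʳ _))
ΣV-transpose i (suc n) xs F = begin
  ΣV i (vecsOf xs (suc n)) F
    ≡⟨ ΣV-splitColumn i n xs F ⟩
  ΣV i xs (λ c → ΣV i (vecsOf xs n) (λ M → F (zipWith _∷_ c M)))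
    ≡⟨ ΣL-cong (vecsOf xs i) (λ c → ΣV-transpose i n xs (λ M → F (zipWith _∷_ c M))) ⟩
  ΣV i xs (λ c → ΣV n (vecsOf xs i) (λ cs → F (transpose (c ∷ cs))))
    ≡⟨ ΣV-suc n (vecsOf xs i) (F ∘ transpose) ⟨
  ΣV (suc n) (vecsOf xs i) (F ∘ transpose) ∎

-- Order invariance

SameOrder : {n : ℕ} → Vec ℕ n → Vec ℕ n → Set
SameOrder a b = ∀ i j → (lookup a i ≤ᵇ lookup a j) ≡ (lookup b i ≤ᵇ lookup b j)

eval-cong : {n : ℕ} (S : Formula n) {a b : Vec ℕ n} → SameOrder a b → eval S a ≡ eval S b
eval-cong (atom i j) a~b = a~b i j
eval-cong tt         a~b = refl
eval-cong ff         a~b = refl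
eval-cong (¬f S)     a~b = cong not (eval-cong S a~b)
eval-cong (S ∧f S′)  a~b = cong₂ _∧_ (eval-cong S a~b) (eval-cong S′ a~b)
eval-cong (S ∨f S′)  a~b = cong₂ _∨_ (eval-cong S a~b) (eval-cong S′ a~b)
eval-cong (S ⇒f S′)  a~b = cong₂ (λ x y → not x ∨ y) (eval-cong S a~b) (eval-cong S′ a~b)
eval-cong (S ⇔f S′)  a~b = cong₂ _⇔ᵇ_ (eval-cong S a~b) (eval-cong S′ a~b)

OrderEmbedding : (ℕ → ℕ) → Set
OrderEmbedding e = ∀ x y → (e x ≤ᵇ e y) ≡ (x ≤ᵇ y)

orderEmbedding : {e : ℕ → ℕ} →
  (∀ {x y} → x ≤ y → e x ≤ e y) → (∀ {x y} → e x ≤ e y → x ≤ y) → OrderEmbedding e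
orderEmbedding mono cancel x y =
  T-injective (ℕ.≤⇒≤ᵇ ∘ cancel ∘ ℕ.≤ᵇ⇒≤ _ _) (ℕ.≤⇒≤ᵇ ∘ mono ∘ ℕ.≤ᵇ⇒≤ _ _)

suc-orderEmbedding : OrderEmbedding suc
suc-orderEmbedding = orderEmbedding s≤s ℕ.≤-pred

sameOrder-map : {n : ℕ} (e : ℕ → ℕ) → OrderEmbedding e → (a b : Vec ℕ n) →
  (∀ j → lookup a j ≡ e (lookup b j)) → SameOrder a b
sameOrder-map e emb a b a≡eb i j =
  trans (cong₂ _≤ᵇ_ (a≡eb i) (a≡eb j)) (emb (lookup b i) (lookup b j))

eval-map : {n : ℕ} (S : Formula n) {e : ℕ → ℕ} → OrderEmbedding e → (w : Vec ℕ n) →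
  eval S (Vec.map e w) ≡ eval S w
eval-map S {e} emb w = eval-cong S (sameOrder-map e emb (Vec.map e w) w (λ j → Vecₚ.lookup-map j e w))

-- skip x enumerates ℕ ∖ {x} in increasing order

skip : ℕ → ℕ → ℕ
skip x s with s <? x
... | yes _ = s
... | no  _ = suc s

skip-< : {x s : ℕ} → s < x → skip x s ≡ s
skip-< {x} {s} s<x with s <? x
... | yes _   = refl
... | no  s≮x = ⊥-elim (s≮x s<x)

skip-≥ : {x s : ℕ} → x ≤ s → skip x s ≡ suc s
skip-≥ {x} {s} x≤s with s <? x
... | yes s<x = ⊥-elim (ℕ.<⇒≱ s<x x≤s)
... | no  _   = refl

skip-≢ : (x s : ℕ) → x ≢ skip x s
skip-≢ x s with s <? x
... | yes s<x = ℕ.<⇒≢ s<x ∘ sym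
... | no  s≮x = λ x≡1+s → s≮x (subst (s <_) (sym x≡1+s) (ℕ.n<1+n s))

skip-mono-≤ : (x : ℕ) {s s′ : ℕ} → s ≤ s′ → skip x s ≤ skip x s′
skip-mono-≤ x {s} {s′} s≤s′ with s <? x | s′ <? x
... | yes _   | yes _    = s≤s′
... | yes _   | no  _    = ℕ.m≤n⇒m≤1+n s≤s′
... | no  s≮x | yes s′<x = ⊥-elim (s≮x (ℕ.≤-<-trans s≤s′ s′<x))
... | no  _   | no  _    = s≤s s≤s′

skip-cancel-≤ : (x : ℕ) {s s′ : ℕ} → skip x s ≤ skip x s′ → s ≤ s′
skip-cancel-≤ x {s} {s′} ≤′ with s <? x | s′ <? x
... | yes _   | yes _    = ≤′
... | yes s<x | no  s′≮x = ℕ.<⇒≤ (ℕ.<-≤-trans s<x (ℕ.≮⇒≥ s′≮x))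
... | no  s≮x | yes s′<x = ⊥-elim (s≮x (ℕ.<-trans ≤′ s′<x))
... | no  _   | no  _    = ℕ.≤-pred ≤′

skip-orderEmbedding : (x : ℕ) → OrderEmbedding (skip x)
skip-orderEmbedding x = orderEmbedding (skip-mono-≤ x) (skip-cancel-≤ x)

skip-injective : (x : ℕ) {s s′ : ℕ} → skip x s ≡ skip x s′ → s ≡ s′
skip-injective x eq =
  ℕ.≤-antisym (skip-cancel-≤ x (ℕ.≤-reflexive eq)) (skip-cancel-≤ x (ℕ.≤-reflexive (sym eq)))

skip-onto : {x t : ℕ} → x ≢ t → ∃[ s ] skip x s ≡ t
skip-onto {x} {t} x≢t with t <? x
... | yes t<x = t , skip-< t<x
skip-onto {x} {zero}  x≢t | no t≮x = ⊥-elim (t≮x (ℕ.n≢0⇒n>0 x≢t))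
skip-onto {x} {suc t} x≢t | no t≮x = t , skip-≥ (ℕ.≤-pred (ℕ.≤∧≢⇒< (ℕ.≮⇒≥ t≮x) x≢t))

skip-fixes-below : (x s : ℕ) → skip x s < x → skip x s ≡ s
skip-fixes-below x s skip<x with s <? x
... | yes _ = refl
... | no  s≮x = ⊥-elim (s≮x (ℕ.<-trans (ℕ.n<1+n s) skip<x))

skip-<-suc : (x : ℕ) {s m : ℕ} → s < m → skip x s < suc m
skip-<-suc x {s} s<m with s <? x
... | yes _ = ℕ.m<n⇒m<1+n s<m
... | no  _ = s≤s s<m

skip-<-cancel : {x s m : ℕ} → x ≤ m → skip x s < suc m → s < m
skip-<-cancel {x} {s} x≤m skip<1+m with s <? x
... | yes s<x = ℕ.<-≤-trans s<x x≤m
... | no  _   = ℕ.≤-pred skip<1+m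

range : ℕ → ℕ → List ℕ
range a zero    = []
range a (suc m) = a ∷ range (suc a) m

range-++ : (a m r : ℕ) → range a (m + r) ≡ range a m ++ range (a + m) r
range-++ a zero    r = cong (λ b → range b r) (sym (ℕ.+-identityʳ a))
range-++ a (suc m) r = cong (a ∷_) (trans (range-++ (suc a) m r)
                                            (cong (λ b → range (suc a) m ++ range b r) (sym (ℕ.+-suc a m))))

range-suc : (a m : ℕ) → range (suc a) m ≡ map suc (range a m)
range-suc a zero    = refl
range-suc a (suc m) = cong (suc a ∷_) (range-suc (suc a) m)

length-range : (a m : ℕ) → length (range a m) ≡ m
length-range a zero    = refl
length-range a (suc m) = cong suc (length-range (suc a) m)

∈-range⁻ : {t : ℕ} (a m : ℕ) → t ∈ₗ range a m → t < a + m
∈-range⁻ a (suc m) (here refl)  = ℕ.m<m+n a z<s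
∈-range⁻ {t} a (suc m) (there t∈) = subst (t <_) (sym (ℕ.+-suc a m)) (∈-range⁻ (suc a) m t∈)

allFin-range : (k : ℕ) → map toℕ (allFin k) ≡ range 0 k
allFin-range k = trans (Listₚ.map-tabulate id toℕ) (tabulate-range k 0)
  where
  tabulate-range : ∀ k a → tabulate {n = k} (λ t → a + toℕ t) ≡ range a k
  tabulate-range zero    a = refl
  tabulate-range (suc k) a = cong₂ _∷_ (ℕ.+-identityʳ a)
    (trans (Listₚ.tabulate-cong (λ t → ℕ.+-suc a (toℕ t))) (tabulate-range k (suc a)))

map-skip-range : (x d : ℕ) → map (skip x) (range 0 (x + d)) ≡ range 0 x ++ range (suc x) d
map-skip-range x d = trans (cong (map (skip x)) (range-++ 0 x d))
  (trans (Listₚ.map-++ (skip x) (range 0 x) (range x d))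
         (cong₂ _++_ (below 0 x ℕ.≤-refl) (above x d ℕ.≤-refl)))
  where
  below : ∀ a m → a + m ≤ x → map (skip x) (range a m) ≡ range a m
  below a zero    _ = refl
  below a (suc m) p =
    cong₂ _∷_ (skip-< (ℕ.<-≤-trans (ℕ.m<m+n a z<s) p)) (below (suc a) m (subst (_≤ x) (ℕ.+-suc a m) p))
  above : ∀ a m → x ≤ a → map (skip x) (range a m) ≡ range (suc a) m
  above a zero    _ = refl
  above a (suc m) p = cong₂ _∷_ (skip-≥ p) (above (suc a) m (ℕ.m≤n⇒m≤1+n p))

ΣL-range-skip : (x d : ℕ) (G : ℕ → ℕ) → G x ≡ 0 →
  ΣL (range 0 (x + suc d)) G ≡ ΣL (range 0 (x + d)) (G ∘ skip x)
ΣL-range-skip x d G Gx≡0 = begin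
  ΣL (range 0 (x + suc d)) G                 ≡⟨ cong (λ xs → ΣL xs G) (range-++ 0 x (suc d)) ⟩
  ΣL (range 0 x ++ x ∷ range (suc x) d) G    ≡⟨ ΣL-++ (range 0 x) (x ∷ range (suc x) d) G ⟩
  ΣL (range 0 x) G + (G x + ΣL above G)      ≡⟨ cong (λ y → ΣL (range 0 x) G + (y + ΣL above G)) Gx≡0 ⟩
  ΣL (range 0 x) G + ΣL above G              ≡⟨ ΣL-++ (range 0 x) above G ⟨
  ΣL (range 0 x ++ above) G                  ≡⟨ cong (λ xs → ΣL xs G) (map-skip-range x d) ⟨
  ΣL (map (skip x) (range 0 (x + d))) G      ≡⟨ ΣL-map (skip x) (range 0 (x + d)) G ⟩
  ΣL (range 0 (x + d)) (G ∘ skip x)          ∎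
  where
  above : List ℕ
  above = range (suc x) d

ΣV-range-skip : (n x d : ℕ) (F : Vec ℕ n → ℕ) → (∀ v → x ∈ v → F v ≡ 0) →
  ΣV n (range 0 (x + suc d)) F ≡ ΣV n (range 0 (x + d)) (F ∘ Vec.map (skip x))
ΣV-range-skip n x d =
  ΣV-reindex n (x ≡_) (range 0 (x + suc d)) (range 0 (x + d)) (skip x) (λ G G0 → ΣL-range-skip x d G (G0 x refl))

-- Vectors using every value below j

_∈ᵇ_ : {n : ℕ} → ℕ → Vec ℕ n → Bool
t ∈ᵇ a = ⌊ t ∈? a ⌋

∈ᵇ-true : {n t : ℕ} {a : Vec ℕ n} → t ∈ a → (t ∈ᵇ a) ≡ true
∈ᵇ-true = to Bool.T-≡ ∘ fromWitness

∈ᵇ-false : {n t : ℕ} {a : Vec ℕ n} → ¬ t ∈ a → (t ∈ᵇ a) ≡ false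
∈ᵇ-false = to Bool.T-not-≡ ∘ fromWitnessFalse

covers : {n : ℕ} → ℕ → Vec ℕ n → Bool
covers zero    a = true
covers (suc j) a = covers j a ∧ (j ∈ᵇ a)

covers⁺ : {n : ℕ} (j : ℕ) {a : Vec ℕ n} → (∀ {t} → t < j → t ∈ a) → T (covers j a)
covers⁺ zero    h = _
covers⁺ (suc j) h = from Bool.T-∧ (covers⁺ j (h ∘ ℕ.m<n⇒m<1+n) , fromWitness (h (ℕ.n<1+n j)))

covers⁻ : {n : ℕ} (j : ℕ) {a : Vec ℕ n} → T (covers j a) → ∀ {t} → t < j → t ∈ a
covers⁻ (suc j) {a} p {t} t<1+j with to (Bool.T-∧ {covers j a}) p | t ≟ j
... | _         , j∈a | yes refl = toWitness j∈a
... | covers-j  , _   | no  t≢j  = covers⁻ j covers-j (ℕ.≤∧≢⇒< (ℕ.≤-pred t<1+j) t≢j)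

covers-cong : {n n′ : ℕ} (j : ℕ) {a : Vec ℕ n} {b : Vec ℕ n′} →
  (∀ {t} → t < j → t ∈ a → t ∈ b) → (∀ {t} → t < j → t ∈ b → t ∈ a) →
  covers j a ≡ covers j b
covers-cong j a⇒b b⇒a = T-injective (λ p → covers⁺ j (λ t<j → a⇒b t<j (covers⁻ j p t<j)))
                                    (λ p → covers⁺ j (λ t<j → b⇒a t<j (covers⁻ j p t<j)))

∉-map-skip : {n : ℕ} (x : ℕ) (w : Vec ℕ n) → ¬ (x ∈ Vec.map (skip x) w)
∉-map-skip x w x∈ = let s , x≡ = VecAny.satisfied (VecAnyₚ.map⁻ x∈) in skip-≢ x s x≡

covers-map-skip : {n : ℕ} (j : ℕ) (w : Vec ℕ n) → covers j (Vec.map (skip j) w) ≡ covers j w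
covers-map-skip j w = covers-cong j unskip (λ t<j t∈w → subst (_∈ _) (skip-< t<j) (∈-map⁺ (skip j) t∈w))
  where
  unskip : ∀ {t} → t < j → t ∈ Vec.map (skip j) w → t ∈ w
  unskip {t} t<j t∈ =
    VecAny.map (λ {s} t≡ → trans t≡ (skip-fixes-below j s (subst (_< j) t≡ t<j))) (VecAnyₚ.map⁻ t∈)

covers-cons-skip : {n : ℕ} {x m : ℕ} (w : Vec ℕ n) → x ≤ m →
  covers (suc m) (x ∷ Vec.map (skip x) w) ≡ covers m w
covers-cons-skip {x = x} {m} w x≤m =
  T-injective (λ p → covers⁺ m (λ s<m → unskip (covers⁻ (suc m) p (skip-<-suc x s<m))))
              (λ p → covers⁺ (suc m) (λ t<1+m → reskip (covers⁻ m p) t<1+m))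
  where
  unskip : ∀ {s} → skip x s ∈ x ∷ Vec.map (skip x) w → s ∈ w
  unskip {s} (here eq) = ⊥-elim (skip-≢ x s (sym eq))
  unskip (there ∈w)    = VecAny.map (skip-injective x) (VecAnyₚ.map⁻ ∈w)
  reskip : (∀ {s} → s < m → s ∈ w) → ∀ {t} → t < suc m → t ∈ x ∷ Vec.map (skip x) w
  reskip covers-w {t} t<1+m with x ≟ t
  ... | yes refl = here refl
  ... | no  x≢t  = let s , skip≡t = skip-onto x≢t
                       s<m = skip-<-cancel x≤m (subst (_< suc m) (sym skip≡t) t<1+m)
                   in there (subst (_∈ _) skip≡t (∈-map⁺ (skip x) (covers-w s<m)))

covers-cons : {n : ℕ} {j x : ℕ} (v : Vec ℕ n) → x < j → covers j (x ∷ v) ∧ (x ∈ᵇ v) ≡ covers j v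
covers-cons {j = j} {x} v x<j with x ∈? v
... | yes x∈v = trans (Bool.∧-identityʳ _) (covers-cong j (λ _ → drop) (λ _ → there))
  where
  drop : ∀ {t} → t ∈ x ∷ v → t ∈ v
  drop (here refl) = x∈v
  drop (there t∈v) = t∈v
... | no  x∉v = trans (Bool.∧-zeroʳ _) (sym (T-injective (λ p → x∉v (covers⁻ j p x<j)) λ ()))

-- Binomial expansion

ind-split : (b c : Bool) → ind b ≡ ind (b ∧ c) + ind (b ∧ not c)
ind-split true  true  = refl
ind-split true  false = refl
ind-split false c     = refl

ΣV-split : (n : ℕ) (xs : List A) (p q : Vec A n → Bool) →
  ΣV n xs (ind ∘ p) ≡ ΣV n xs (λ v → ind (p v ∧ q v)) + ΣV n xs (λ v → ind (p v ∧ not (q v)))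
ΣV-split n xs p q = trans (ΣV-cong n xs (λ v → ind-split (p v) (q v))) (ΣL-+ (vecsOf xs n) _ _)

sumTo : ℕ → (ℕ → ℕ) → ℕ
sumTo zero    h = 0
sumTo (suc m) h = h 0 + sumTo m (h ∘ suc)

sumTo-cong : (m : ℕ) {h h′ : ℕ → ℕ} → (∀ t → h t ≡ h′ t) → sumTo m h ≡ sumTo m h′
sumTo-cong zero    eq = refl
sumTo-cong (suc m) eq = cong₂ _+_ (eq 0) (sumTo-cong m (eq ∘ suc))

sumTo-+ : (m : ℕ) (h h′ : ℕ → ℕ) → sumTo m (λ t → h t + h′ t) ≡ sumTo m h + sumTo m h′
sumTo-+ zero    h h′ = refl
sumTo-+ (suc m) h h′ =
  trans (cong (h 0 + h′ 0 +_) (sumTo-+ m (h ∘ suc) (h′ ∘ suc))) (interchange (h 0) (h′ 0) _ _)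

sumTo-zero : (m : ℕ) {h : ℕ → ℕ} → (∀ t → h t ≡ 0) → sumTo m h ≡ 0
sumTo-zero zero    eq = refl
sumTo-zero (suc m) eq = cong₂ _+_ (eq 0) (sumTo-zero m (eq ∘ suc))

sumTo-truncate : (m d : ℕ) (h : ℕ → ℕ) → (∀ t → m ≤ t → h t ≡ 0) → sumTo (m + d) h ≡ sumTo m h
sumTo-truncate zero    d h eq = sumTo-zero d (λ t → eq t z≤n)
sumTo-truncate (suc m) d h eq = cong (h 0 +_) (sumTo-truncate m d (h ∘ suc) (λ t m≤t → eq (suc t) (s≤s m≤t)))

C-suc : (r t : ℕ) → suc r C suc t ≡ r C t + r C suc t
C-suc r t = sym (nCk+nC[k+1]≡[n+1]C[k+1] r t)

module Expansion {n : ℕ} (P : Vec ℕ n → Bool) (P-skip : ∀ x w → P (Vec.map (skip x) w) ≡ P w) where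

  N : ℕ → ℕ → ℕ
  N j r = ΣV n (range 0 (j + r)) (λ a → ind (P a ∧ covers j a))

  -- Split on whether the value j is used; if it is not, closing the gap it leaves
  -- preserves both P and coverage of the values below j.
  N-suc : (j r : ℕ) → N j (suc r) ≡ N (suc j) r + N j r
  N-suc j r = trans (ΣV-split n (range 0 (j + suc r)) (λ a → P a ∧ covers j a) (j ∈ᵇ_))
                    (cong₂ _+_ used unused)
    where
    used : ΣV n (range 0 (j + suc r)) (λ a → ind ((P a ∧ covers j a) ∧ (j ∈ᵇ a))) ≡ N (suc j) r
    used = trans (ΣV-cong n _ (λ a → cong ind (Bool.∧-assoc (P a) (covers j a) (j ∈ᵇ a))))
                 (cong (λ m → ΣV n (range 0 m) (λ a → ind (P a ∧ covers (suc j) a))) (ℕ.+-suc j r))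
    U : Vec ℕ n → ℕ
    U a = ind ((P a ∧ covers j a) ∧ not (j ∈ᵇ a))
    U-used : ∀ a → j ∈ a → U a ≡ 0
    U-used a j∈a =
      trans (cong (λ b → ind ((P a ∧ covers j a) ∧ not b)) (∈ᵇ-true j∈a)) (cong ind (Bool.∧-zeroʳ _))
    U-skip : ∀ w → U (Vec.map (skip j) w) ≡ ind (P w ∧ covers j w)
    U-skip w = cong ind (begin
      (P (Vec.map (skip j) w) ∧ covers j (Vec.map (skip j) w)) ∧ not (j ∈ᵇ Vec.map (skip j) w)
        ≡⟨ cong₂ (λ p c → (p ∧ c) ∧ not (j ∈ᵇ Vec.map (skip j) w)) (P-skip j w) (covers-map-skip j w) ⟩
      (P w ∧ covers j w) ∧ not (j ∈ᵇ Vec.map (skip j) w)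
        ≡⟨ cong (λ b → (P w ∧ covers j w) ∧ not b) (∈ᵇ-false (∉-map-skip j w)) ⟩
      (P w ∧ covers j w) ∧ true
        ≡⟨ Bool.∧-identityʳ _ ⟩
      P w ∧ covers j w ∎)
    unused : ΣV n (range 0 (j + suc r)) U ≡ N j r
    unused = trans (ΣV-range-skip n j r U U-used) (ΣV-cong n _ U-skip)

  N-expansion : (r j M : ℕ) → r < M → N j r ≡ sumTo M (λ t → (r C t) * N (j + t) 0)
  N-expansion zero j (suc M) _ = begin
    N j 0                                        ≡⟨ cong (λ i → N i 0) (ℕ.+-identityʳ j) ⟨
    N (j + 0) 0                                  ≡⟨ ℕ.*-identityˡ (N (j + 0) 0) ⟨
    (0 C 0) * N (j + 0) 0                        ≡⟨ ℕ.+-identityʳ _ ⟨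
    (0 C 0) * N (j + 0) 0 + 0                    ≡⟨ cong (_ +_) (sumTo-zero M (λ _ → refl)) ⟨
    sumTo (suc M) (λ t → (0 C t) * N (j + t) 0)  ∎
  N-expansion (suc r) j (suc M) (s≤s r<M) = begin
    N j (suc r)                                              ≡⟨ N-suc j r ⟩
    N (suc j) r + N j r                                      ≡⟨ cong₂ _+_ (N-expansion r (suc j) M r<M)
                                                                          (N-expansion r j (suc M) (ℕ.m<n⇒m<1+n r<M)) ⟩
    sumTo M (λ t → (r C t) * s (suc j + t)) + (s₀ + sumTo M b)
                                                             ≡⟨ cong (_+ (s₀ + sumTo M b)) (sumTo-cong M shift) ⟩
    sumTo M a + (s₀ + sumTo M b)                             ≡⟨ x∙yz≈y∙xz (sumTo M a) s₀ (sumTo M b) ⟩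
    s₀ + (sumTo M a + sumTo M b)                             ≡⟨ cong (s₀ +_) (sumTo-+ M a b) ⟨
    s₀ + sumTo M (λ t → a t + b t)                           ≡⟨ cong (s₀ +_) (sumTo-cong M pascal) ⟩
    sumTo (suc M) (λ t → (suc r C t) * s (j + t))            ∎
    where
    s : ℕ → ℕ
    s i = N i 0
    s₀ : ℕ
    s₀ = (suc r C 0) * s (j + 0)
    a b : ℕ → ℕ
    a t = (r C t) * s (j + suc t)
    b t = (r C suc t) * s (j + suc t)
    shift : ∀ t → (r C t) * s (suc j + t) ≡ a t
    shift t = cong (λ i → (r C t) * s i) (sym (ℕ.+-suc j t))
    pascal : ∀ t → a t + b t ≡ (suc r C suc t) * s (j + suc t)
    pascal t = trans (sym (ℕ.*-distribʳ-+ (s (j + suc t)) (r C t) (r C suc t)))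
                     (cong (_* s (j + suc t)) (sym (C-suc r t)))

surjections : ℕ → ℕ → ℕ
surjections n i = ΣV n (range 0 i) (ind ∘ covers i)

-- The first value x is either used again, or removing it leaves a surjection onto i values.
surjections-firstValue : (n i x : ℕ) → x ≤ i →
  ΣV n (range 0 (suc i)) (λ v → ind (covers (suc i) (x ∷ v))) ≡ surjections n (suc i) + surjections n i
surjections-firstValue n i x x≤i =
  trans (ΣV-split n (range 0 (suc i)) (covers (suc i) ∘ (x ∷_)) (x ∈ᵇ_)) (cong₂ _+_ used unused)
  where
  used : ΣV n (range 0 (suc i)) (λ v → ind (covers (suc i) (x ∷ v) ∧ (x ∈ᵇ v))) ≡ surjections n (suc i)
  used = ΣV-cong n _ (λ v → cong ind (covers-cons v (s≤s x≤i)))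
  U : Vec ℕ n → ℕ
  U v = ind (covers (suc i) (x ∷ v) ∧ not (x ∈ᵇ v))
  U-used : ∀ v → x ∈ v → U v ≡ 0
  U-used v x∈v =
    trans (cong (λ b → ind (covers (suc i) (x ∷ v) ∧ not b)) (∈ᵇ-true x∈v)) (cong ind (Bool.∧-zeroʳ _))
  U-skip : ∀ w → U (Vec.map (skip x) w) ≡ ind (covers i w)
  U-skip w = cong ind (begin
    covers (suc i) (x ∷ Vec.map (skip x) w) ∧ not (x ∈ᵇ Vec.map (skip x) w)
      ≡⟨ cong (λ b → covers (suc i) (x ∷ Vec.map (skip x) w) ∧ not b) (∈ᵇ-false (∉-map-skip x w)) ⟩
    covers (suc i) (x ∷ Vec.map (skip x) w) ∧ true
      ≡⟨ Bool.∧-identityʳ _ ⟩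
    covers (suc i) (x ∷ Vec.map (skip x) w)
      ≡⟨ covers-cons-skip w x≤i ⟩
    covers i w ∎)
  x+d≡i : x + (i ∸ x) ≡ i
  x+d≡i = ℕ.m+[n∸m]≡n x≤i
  x+1+d≡1+i : x + suc (i ∸ x) ≡ suc i
  x+1+d≡1+i = trans (ℕ.+-suc x (i ∸ x)) (cong suc x+d≡i)
  unused : ΣV n (range 0 (suc i)) U ≡ surjections n i
  unused = begin
    ΣV n (range 0 (suc i)) U                         ≡⟨ cong (λ m → ΣV n (range 0 m) U) x+1+d≡1+i ⟨
    ΣV n (range 0 (x + suc (i ∸ x))) U               ≡⟨ ΣV-range-skip n x (i ∸ x) U U-used ⟩
    ΣV n (range 0 (x + (i ∸ x))) (U ∘ Vec.map (skip x)) ≡⟨ ΣV-cong n _ U-skip ⟩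
    ΣV n (range 0 (x + (i ∸ x))) (ind ∘ covers i)    ≡⟨ cong (λ m → ΣV n (range 0 m) (ind ∘ covers i)) x+d≡i ⟩
    surjections n i                                  ∎

surjections-suc : (n i : ℕ) → surjections (suc n) (suc i) ≡ suc i * (surjections n (suc i) + surjections n i)
surjections-suc n i = begin
  surjections (suc n) (suc i)
    ≡⟨ ΣV-suc n (range 0 (suc i)) (ind ∘ covers (suc i)) ⟩
  ΣL (range 0 (suc i)) (λ x → ΣV n (range 0 (suc i)) (λ v → ind (covers (suc i) (x ∷ v))))
    ≡⟨ ΣL-cong∈ (range 0 (suc i)) (λ x x∈ → surjections-firstValue n i x (ℕ.≤-pred (∈-range⁻ 0 _ x∈))) ⟩
  ΣL (range 0 (suc i)) (λ _ → surjections n (suc i) + surjections n i)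
    ≡⟨ ΣL-const (range 0 (suc i)) _ ⟩
  length (range 0 (suc i)) * (surjections n (suc i) + surjections n i)
    ≡⟨ cong (_* (surjections n (suc i) + surjections n i)) (length-range 0 (suc i)) ⟩
  suc i * (surjections n (suc i) + surjections n i) ∎

surjections≡ : (n i : ℕ) → surjections n i ≡ (i !) * Stirling2 n i
surjections≡ zero    zero    = refl
surjections≡ zero    (suc i) =
  trans (cong (λ b → ind b + 0) (Bool.∧-zeroʳ (covers i []))) (sym (ℕ.*-zeroʳ (suc i !)))
surjections≡ (suc n) zero    = refl
surjections≡ (suc n) (suc i) = begin
  surjections (suc n) (suc i)
    ≡⟨ surjections-suc n i ⟩
  suc i * (surjections n (suc i) + surjections n i)
    ≡⟨ cong (suc i *_) (cong₂ _+_ (surjections≡ n (suc i)) (surjections≡ n i)) ⟩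
  suc i * ((suc i !) * Stirling2 n (suc i) + (i !) * Stirling2 n i)
    ≡⟨ distribute (suc i) (i !) (Stirling2 n (suc i)) (Stirling2 n i) ⟩
  (suc i !) * Stirling2 (suc n) (suc i) ∎
  where
  open +-*-Solver
  distribute : ∀ a f p q → a * ((a * f) * p + f * q) ≡ (a * f) * (a * p + q)
  distribute = solve 4 (λ a f p q → a :* ((a :* f) :* p :+ f :* q) := (a :* f) :* (a :* p :+ q)) refl

-- Ordered set partitions with i blocks are surjections onto [0, i)

_∈ᴮ_ : {n : ℕ} → Fin n → Block n → Set
j ∈ᴮ b = T (lookup b j)

record IsOSP {n ℓ : ℕ} (Φ : Vec (Block n) ℓ) : Set where
  field
    nonempty : ∀ t → ∃[ j ] j ∈ᴮ lookup Φ t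
    disjoint : ∀ {t t′} → toℕ t < toℕ t′ → ∀ j → j ∈ᴮ lookup Φ t → j ∈ᴮ lookup Φ t′ → ⊥
    covering : ∀ j → ∃[ t ] j ∈ᴮ lookup Φ t

T-disjointᵇ : {n : ℕ} (b c : Block n) → T (disjointᵇ b c) ⇔ (∀ j → j ∈ᴮ b → j ∈ᴮ c → ⊥)
T-disjointᵇ b c = mk⇔
  (λ p j j∈b j∈c → to T-not (to (T-all-allFin notBoth) p j) (from Bool.T-∧ (j∈b , j∈c)))
  (λ h → from (T-all-allFin notBoth) (λ j → from T-not (λ j∈b∩c →
     let j∈b , j∈c = to (Bool.T-∧ {lookup b j}) j∈b∩c in h j j∈b j∈c)))
  where
  notBoth : Fin _ → Bool
  notBoth j = not (lookup b j ∧ lookup c j)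

isOSPᵇ⇔IsOSP : {n ℓ : ℕ} (Φ : Vec (Block n) ℓ) → T (isOSPᵇ Φ) ⇔ IsOSP Φ
isOSPᵇ⇔IsOSP {n} {ℓ} Φ = mk⇔ sound complete
  where
  nonemptyAt : Fin ℓ → Bool
  nonemptyAt t = nonemptyᵇ (lookup Φ t)

  ordered : Fin ℓ → Fin ℓ → Bool
  ordered t t′ = not (toℕ t <ᵇ toℕ t′) ∨ disjointᵇ (lookup Φ t) (lookup Φ t′)

  coveredAt : Fin n → Bool
  coveredAt j = or (map (λ t → lookup (lookup Φ t) j) (allFin ℓ))

  nonemptyAll : T (and (map nonemptyAt (allFin ℓ))) ⇔ (∀ t → T (nonemptyAt t))
  nonemptyAll = T-all-allFin nonemptyAt

  orderedAll : T (and (concatMap (λ t → map (ordered t) (allFin ℓ)) (allFin ℓ))) ⇔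
               (∀ t → T (and (map (ordered t) (allFin ℓ))))
  orderedAll = T-all-concatMap-allFin (λ t → map (ordered t) (allFin ℓ))

  coveredAll : T (and (map coveredAt (allFin n))) ⇔ (∀ j → T (coveredAt j))
  coveredAll = T-all-allFin coveredAt

  blocksDisjoint : ∀ t t′ →
    T (disjointᵇ (lookup Φ t) (lookup Φ t′)) ⇔ (∀ j → j ∈ᴮ lookup Φ t → j ∈ᴮ lookup Φ t′ → ⊥)
  blocksDisjoint t t′ = T-disjointᵇ (lookup Φ t) (lookup Φ t′)

  sound : T (isOSPᵇ Φ) → IsOSP Φ
  sound p = record
    { nonempty = λ t → to (T-or-toList (lookup Φ t)) (to nonemptyAll ne t)
    ; disjoint = λ {t} {t′} →
        to (blocksDisjoint t t′) ∘ to (T-<ᵇ⇒ _ _) (to (T-all-allFin (ordered t)) (to orderedAll dj t) t′)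
    ; covering = λ j → to (T-any-allFin (λ t → lookup (lookup Φ t) j)) (to coveredAll cv j)
    }
    where
    ne : T (and (map nonemptyAt (allFin ℓ)))
    ne = proj₁ (to Bool.T-∧ p)
    dj : T (and (concatMap (λ t → map (ordered t) (allFin ℓ)) (allFin ℓ)))
    dj = proj₁ (to Bool.T-∧ (proj₂ (to (Bool.T-∧ {and (map nonemptyAt (allFin ℓ))}) p)))
    cv : T (and (map coveredAt (allFin n)))
    cv = proj₂ (to Bool.T-∧ (proj₂ (to (Bool.T-∧ {and (map nonemptyAt (allFin ℓ))}) p)))

  complete : IsOSP Φ → T (isOSPᵇ Φ)
  complete osp = from Bool.T-∧ (ne , from Bool.T-∧ (dj , cv))
    where
    open IsOSP osp
    ne : T (and (map nonemptyAt (allFin ℓ)))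
    ne = from nonemptyAll (λ t → from (T-or-toList (lookup Φ t)) (nonempty t))
    dj : T (and (concatMap (λ t → map (ordered t) (allFin ℓ)) (allFin ℓ)))
    dj = from orderedAll (λ t → from (T-all-allFin (ordered t)) (λ t′ →
           from (T-<ᵇ⇒ (toℕ t) (toℕ t′)) (from (blocksDisjoint t t′) ∘ disjoint)))
    cv : T (and (map coveredAt (allFin n)))
    cv = from coveredAll (λ j → from (T-any-allFin (λ t → lookup (lookup Φ t) j)) (covering j))

-- The indicator vector of {t}; all false when t ≥ k.
unit : {k : ℕ} → ℕ → Vec Bool k
unit {zero}  t       = []
unit {suc k} zero    = true ∷ replicate k false
unit {suc k} (suc t) = false ∷ unit t

lookup-unit : {k : ℕ} (t : ℕ) (s : Fin k) → lookup (unit t) s ≡ (toℕ s ≡ᵇ t)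
lookup-unit zero    Fin.zero    = refl
lookup-unit zero    (Fin.suc s) = Vecₚ.lookup-replicate s false
lookup-unit (suc t) Fin.zero    = refl
lookup-unit (suc t) (Fin.suc s) = lookup-unit t s

ExactlyOne : {k : ℕ} → Vec Bool k → Set
ExactlyOne {k} b =
  (∃[ t ] T (lookup b t)) × (∀ {t t′ : Fin k} → toℕ t < toℕ t′ → T (lookup b t) → T (lookup b t′) → ⊥)

exactlyOne-tail : {k : ℕ} {b : Vec Bool k} → ExactlyOne (false ∷ b) → ExactlyOne b
exactlyOne-tail ((Fin.suc t , bt) , unique) = (t , bt) , λ t<t′ → unique (s≤s t<t′)

Bools : List Bool
Bools = true ∷ false ∷ []

ΣL-Bools : (k : ℕ) (G : Vec Bool (suc k) → ℕ) →
  ΣL (vecsOf Bools (suc k)) G ≡ ΣV k Bools (G ∘ (true ∷_)) + ΣV k Bools (G ∘ (false ∷_))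
ΣL-Bools k G = trans (ΣV-suc k Bools G) (cong (ΣV k Bools (G ∘ (true ∷_)) +_) (ℕ.+-identityʳ _))

ΣL-allFalse : (k : ℕ) (G : Vec Bool k → ℕ) → (∀ b t → T (lookup b t) → G b ≡ 0) →
  ΣL (vecsOf Bools k) G ≡ G (replicate k false)
ΣL-allFalse zero    G G-true = ℕ.+-identityʳ (G [])
ΣL-allFalse (suc k) G G-true = begin
  ΣL (vecsOf Bools (suc k)) G                                 ≡⟨ ΣL-Bools k G ⟩
  ΣV k Bools (G ∘ (true ∷_)) + ΣV k Bools (G ∘ (false ∷_))    ≡⟨ cong (_+ ΣV k Bools (G ∘ (false ∷_))) (ΣL-zero (vecsOf Bools k) G-head) ⟩
  ΣV k Bools (G ∘ (false ∷_))                                 ≡⟨ ΣL-allFalse k (G ∘ (false ∷_)) G-tail ⟩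
  G (replicate (suc k) false)                                 ∎
  where
  G-head : ∀ b → G (true ∷ b) ≡ 0
  G-head b = G-true (true ∷ b) Fin.zero _
  G-tail : ∀ b t → T (lookup b t) → G (false ∷ b) ≡ 0
  G-tail b t = G-true (false ∷ b) (Fin.suc t)

ΣL-exactlyOne : (k : ℕ) (G : Vec Bool k → ℕ) → (∀ b → ¬ ExactlyOne b → G b ≡ 0) →
  ΣL (vecsOf Bools k) G ≡ ΣL (range 0 k) (G ∘ unit)
ΣL-exactlyOne zero    G G-other = cong (_+ 0) (G-other [] (λ { ((() , _) , _) }))
ΣL-exactlyOne (suc k) G G-other = begin
  ΣL (vecsOf Bools (suc k)) G                                 ≡⟨ ΣL-Bools k G ⟩
  ΣV k Bools (G ∘ (true ∷_)) + ΣV k Bools (G ∘ (false ∷_))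
    ≡⟨ cong₂ _+_ (ΣL-allFalse k (G ∘ (true ∷_)) G-head) (ΣL-exactlyOne k (G ∘ (false ∷_)) G-tail) ⟩
  G (unit 0) + ΣL (range 0 k) (G ∘ unit ∘ suc)                ≡⟨ cong (G (unit 0) +_) (ΣL-map suc (range 0 k) (G ∘ unit)) ⟨
  G (unit 0) + ΣL (map suc (range 0 k)) (G ∘ unit)            ≡⟨ cong (λ xs → G (unit 0) + ΣL xs (G ∘ unit)) (range-suc 0 k) ⟨
  ΣL (range 0 (suc k)) (G ∘ unit)                             ∎
  where
  G-head : ∀ b t → T (lookup b t) → G (true ∷ b) ≡ 0
  G-head b t bt = G-other (true ∷ b) (λ (_ , unique) → unique z<s _ bt)
  G-tail : ∀ b → ¬ ExactlyOne b → G (false ∷ b) ≡ 0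
  G-tail b ¬one = G-other (false ∷ b) (¬one ∘ exactlyOne-tail)

ΣV-unitColumns : (n k : ℕ) (F : Vec (Vec Bool k) n → ℕ) →
  (∀ M → Any (¬_ ∘ ExactlyOne) M → F M ≡ 0) → ΣV n (vecsOf Bools k) F ≡ ΣV n (range 0 k) (F ∘ Vec.map unit)
ΣV-unitColumns n k = ΣV-reindex n (¬_ ∘ ExactlyOne) (vecsOf Bools k) (range 0 k) unit (ΣL-exactlyOne k)

exactlyOne-columns : {n ℓ : ℕ} (M : Vec (Vec Bool ℓ) n) → IsOSP (transpose M) → ∀ j → ExactlyOne (lookup M j)
exactlyOne-columns M osp j =
  (let t , j∈t = covering j in t , subst T (lookup-transpose M t j) j∈t) ,
  (λ {t} {t′} t<t′ p p′ → disjoint t<t′ j (subst T (sym (lookup-transpose M t j)) p)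
                                           (subst T (sym (lookup-transpose M t′ j)) p′))
  where open IsOSP osp

blockOf-unique : {n ℓ : ℕ} (Φ : Vec (Block n) ℓ) (j : Fin n) (v : ℕ) → v < ℓ →
  (∀ t → lookup (lookup Φ t) j ≡ (toℕ t ≡ᵇ v)) → blockOf Φ j ≡ suc v
blockOf-unique (b ∷ Φ) j zero    _         in-t = cong (λ x → if x then 1 else suc (blockOf Φ j)) (in-t Fin.zero)
blockOf-unique (b ∷ Φ) j (suc v) (s≤s v<ℓ) in-t =
  trans (cong (λ x → if x then 1 else suc (blockOf Φ j)) (in-t Fin.zero))
        (cong suc (blockOf-unique Φ j v v<ℓ (in-t ∘ Fin.suc)))

-- The ordered set partition of [n] into the fibres of c : [n] → [0, i)
module Fibres {n i : ℕ} (c : Vec ℕ n) (c<i : ∀ j → lookup c j < i) where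

  fibres : Vec (Block n) i
  fibres = transpose (Vec.map unit c)

  lookup-fibres : ∀ t j → lookup (lookup fibres t) j ≡ (toℕ t ≡ᵇ lookup c j)
  lookup-fibres t j = trans (lookup-transpose (Vec.map unit c) t j)
                            (trans (cong (λ b → lookup b t) (Vecₚ.lookup-map j unit c)) (lookup-unit (lookup c j) t))

  ∈-fibres⁻ : ∀ {t j} → j ∈ᴮ lookup fibres t → toℕ t ≡ lookup c j
  ∈-fibres⁻ {t} {j} = ℕ.≡ᵇ⇒≡ _ _ ∘ subst T (lookup-fibres t j)

  ∈-fibres⁺ : ∀ {t j} → toℕ t ≡ lookup c j → j ∈ᴮ lookup fibres t
  ∈-fibres⁺ {t} {j} = subst T (sym (lookup-fibres t j)) ∘ ℕ.≡⇒≡ᵇ _ _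

  isOSP-fibres : T (covers i c) → IsOSP fibres
  isOSP-fibres p = record
    { nonempty = λ t → let t∈c = covers⁻ i p (Finₚ.toℕ<n t) in
                       VecAny.index t∈c , ∈-fibres⁺ (VecAnyₚ.lookup-index t∈c)
    ; disjoint = λ t<t′ j p p′ → ℕ.<⇒≢ t<t′ (trans (∈-fibres⁻ p) (sym (∈-fibres⁻ p′)))
    ; covering = λ j → Fin.fromℕ< (c<i j) , ∈-fibres⁺ (Finₚ.toℕ-fromℕ< (c<i j))
    }

  covers-fibres : IsOSP fibres → T (covers i c)
  covers-fibres osp = covers⁺ i λ {t} t<i →
    let j , j∈ = IsOSP.nonempty osp (Fin.fromℕ< t<i) in
    subst (_∈ c) (trans (sym (∈-fibres⁻ j∈)) (Finₚ.toℕ-fromℕ< t<i)) (∈-lookup j c)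

  isOSPᵇ-fibres : isOSPᵇ fibres ≡ covers i c
  isOSPᵇ-fibres = T-injective (covers-fibres ∘ to (isOSPᵇ⇔IsOSP fibres))
                              (from (isOSPᵇ⇔IsOSP fibres) ∘ isOSP-fibres)

  solvesᵇ-fibres : (S : Formula n) → solvesᵇ S fibres ≡ eval S c
  solvesᵇ-fibres S = eval-cong S (sameOrder-map suc suc-orderEmbedding (canonical fibres) c canonical-fibres)
    where
    canonical-fibres : ∀ j → lookup (canonical fibres) j ≡ suc (lookup c j)
    canonical-fibres j = trans (Vecₚ.lookup∘tabulate (blockOf fibres) j)
                               (blockOf-unique fibres j (lookup c j) (c<i j) (λ t → lookup-fibres t j))

f≡ : {n : ℕ} (S : Formula n) (i : ℕ) → f S i ≡ ΣV n (range 0 i) (λ c → ind (eval S c ∧ covers i c))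
f≡ {n} S i = begin
  f S i                                                  ≡⟨ length-filterᵇ W (vecsOf (vecsOf Bools n) i) ⟩
  ΣV i (vecsOf Bools n) (ind ∘ W)                        ≡⟨ ΣV-transpose i n Bools (ind ∘ W) ⟩
  ΣV n (vecsOf Bools i) (ind ∘ W ∘ transpose)            ≡⟨ ΣV-unitColumns n i (ind ∘ W ∘ transpose) not-OSP ⟩
  ΣV n (range 0 i) (ind ∘ W ∘ transpose ∘ Vec.map unit)  ≡⟨ ΣV-cong∈ n (range 0 i) by-fibres ⟩
  ΣV n (range 0 i) (λ c → ind (eval S c ∧ covers i c))   ∎
  where
  W : Vec (Block n) i → Bool
  W Φ = isOSPᵇ Φ ∧ solvesᵇ S Φ
  not-OSP : ∀ M → Any (¬_ ∘ ExactlyOne) M → ind (W (transpose M)) ≡ 0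
  not-OSP M bad = cong (λ b → ind (b ∧ solvesᵇ S (transpose M))) (T-injective {b = false} osp⇒⊥ λ ())
    where
    osp⇒⊥ : T (isOSPᵇ (transpose M)) → ⊥
    osp⇒⊥ p = VecAll.lookupWith (λ one ¬one → ¬one one)
                (VecAllₚ.lookup⁻ (exactlyOne-columns M (to (isOSPᵇ⇔IsOSP (transpose M)) p))) bad
  by-fibres : ∀ c → All (_∈ₗ range 0 i) c → ind (W (transpose (Vec.map unit c))) ≡ ind (eval S c ∧ covers i c)
  by-fibres c c∈ =
    cong ind (trans (cong₂ _∧_ isOSPᵇ-fibres (solvesᵇ-fibres S)) (Bool.∧-comm (covers i c) (eval S c)))
    where open Fibres c (λ j → ∈-range⁻ 0 i (VecAllₚ.lookup⁺ c∈ j))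

ind-∧-≤ : (b c : Bool) → ind (b ∧ c) ≤ ind c
ind-∧-≤ true  c     = ℕ.≤-refl
ind-∧-≤ false true  = z≤n
ind-∧-≤ false false = z≤n

f≤ : {n : ℕ} (S : Formula n) (i : ℕ) → f S i ≤ (i !) * Stirling2 n i
f≤ {n} S i = subst₂ _≤_ (sym (f≡ S i)) (surjections≡ n i)
  (ΣL-mono-≤ (vecsOf (range 0 i) n) (λ c → ind-∧-≤ (eval S c) (covers i c)))

Stirling2-> : (n t : ℕ) → n < t → Stirling2 n t ≡ 0
Stirling2-> zero    (suc t) _         = refl
Stirling2-> (suc n) (suc t) (s≤s n<t) = cong₂ _+_
  (trans (cong (suc t *_) (Stirling2-> n (suc t) (ℕ.m<n⇒m<1+n n<t))) (ℕ.*-zeroʳ (suc t)))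
  (Stirling2-> n t n<t)

f-> : {n : ℕ} (S : Formula n) (t : ℕ) → n < t → f S t ≡ 0
f-> {n} S t n<t = ℕ.n≤0⇒n≡0 (subst (f S t ≤_) t!*0≡0 (f≤ S t))
  where
  t!*0≡0 : (t !) * Stirling2 n t ≡ 0
  t!*0≡0 = trans (cong ((t !) *_) (Stirling2-> n t n<t)) (ℕ.*-zeroʳ (t !))

Σ₁≡sumTo : (n : ℕ) (g : ℕ → ℕ) → Σ₁ n g ≡ sumTo n (g ∘ suc)
Σ₁≡sumTo n g = go n id
  where
  go : ∀ m (h : ℕ → ℕ) → sum (map (g ∘ suc) (applyUpTo h m)) ≡ sumTo m (g ∘ suc ∘ h)
  go zero    h = refl
  go (suc m) h = cong (g (suc (h 0)) +_) (go m (h ∘ suc))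

χ≡ΣV : {n : ℕ} (S : Formula n) (k : ℕ) → χ S k ≡ ΣV n (range 0 k) (ind ∘ eval S)
χ≡ΣV {n} S k = begin
  χ S k                                         ≡⟨ length-filterᵇ (eval S ∘ schedule) (vecsOf (allFin k) n) ⟩
  ΣV n (allFin k) (ind ∘ eval S ∘ schedule)     ≡⟨ ΣV-cong n (allFin k) (cong ind ∘ eval-schedule) ⟩
  ΣV n (allFin k) (ind ∘ eval S ∘ Vec.map toℕ)  ≡⟨ ΣV-map n toℕ (allFin k) (ind ∘ eval S) ⟨
  ΣV n (map toℕ (allFin k)) (ind ∘ eval S)      ≡⟨ cong (λ xs → ΣV n xs (ind ∘ eval S)) (allFin-range k) ⟩
  ΣV n (range 0 k) (ind ∘ eval S)               ∎
  where
  eval-schedule : ∀ a → eval S (schedule a) ≡ eval S (Vec.map toℕ a)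
  eval-schedule a = eval-cong S (sameOrder-map suc suc-orderEmbedding (schedule a) (Vec.map toℕ a)
    (λ j → trans (Vecₚ.lookup∘tabulate _ j) (cong suc (sym (Vecₚ.lookup-map j toℕ a)))))

χ≡ : (n : ℕ) (S : Formula (suc n)) (k : ℕ) → χ S k ≡ Σ₁ (suc n) (λ i → f S i * (k C i))
χ≡ n S k = begin
  χ S k                                            ≡⟨ χ≡ΣV S k ⟩
  ΣV (suc n) (range 0 k) (ind ∘ eval S)            ≡⟨ ΣV-cong (suc n) (range 0 k) (cong ind ∘ ∧-true) ⟩
  N 0 k                                            ≡⟨ N-expansion k 0 (suc (suc n) + k) (ℕ.m<n+m k z<s) ⟩
  sumTo (suc (suc n) + k) term                     ≡⟨ sumTo-truncate (suc (suc n)) k term term-vanishes ⟩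
  sumTo (suc (suc n)) term                         ≡⟨ sumTo-cong (suc n) term-suc ⟩
  sumTo (suc n) (λ t → f S (suc t) * (k C suc t))  ≡⟨ Σ₁≡sumTo (suc n) (λ i → f S i * (k C i)) ⟨
  Σ₁ (suc n) (λ i → f S i * (k C i))               ∎
  where
  open Expansion (eval S) (λ x → eval-map S (skip-orderEmbedding x))
  ∧-true : ∀ a → eval S a ≡ eval S a ∧ covers 0 a
  ∧-true a = sym (Bool.∧-identityʳ (eval S a))
  term : ℕ → ℕ
  term t = (k C t) * N t 0
  N≡f : ∀ t → N t 0 ≡ f S t
  N≡f t = trans (cong (λ m → ΣV (suc n) (range 0 m) (λ a → ind (eval S a ∧ covers t a))) (ℕ.+-identityʳ t))
                (sym (f≡ S t))
  term-vanishes : ∀ t → suc n < t → term t ≡ 0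
  term-vanishes t n<t = trans (cong ((k C t) *_) (trans (N≡f t) (f-> S t n<t))) (ℕ.*-zeroʳ (k C t))
  term-suc : ∀ t → term (suc t) ≡ f S (suc t) * (k C suc t)
  term-suc t = trans (cong ((k C suc t) *_) (N≡f (suc t))) (ℕ.*-comm (k C suc t) _)

mainTheorem1 : (n : ℕ) → 1 ≤ n → (S : Formula n) →
    ((k : ℕ) → 1 ≤ k → χ S k ≡ Σ₁ n (λ i → f S i * (k C i)))
    × ((i : ℕ) → 1 ≤ i → i ≤ n → f S i ≤ (i !) * Stirling2 n i)
mainTheorem1 (suc n) _ S = (λ k _ → χ≡ n S k) , (λ i _ _ → f≤ S i)
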